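{- For every $n,r$ with $r\le n^2$, there exists an $n$-vertex directed graph $G$ and a set $\mathcal{P}$ of $r$ vertex pairs such that any 2-fault-tolerant reachability subgraph of $G$ for $\mathcal{P}$ has $\Omega(n\sqrt{|\mathcal{P}|})$ edges.
   Context: A subgraph $H$ of $G=(V,E)$ is a $k$-fault-tolerant reachability subgraph of $G$ for $\mathcal{P}\subseteq V\times V$ if for every pair $(s,t)\in\mathcal{P}$ and every set $F\subseteq E$ of at most $k$ edges, $t$ is reachable from $s$ in $G\setminus F$ if and only if $t$ is reachable from $s$ in $H\setminus F$. -}

module Defs where

open import Data.Nat using (ℕ; _+_; _≤_)
open import Data.Bool using (Bool; true; false; _∧_; not; if_then_else_)
open import Data.Fin using (Fin)
open import Data.List using (List; map; allFin)
open import Data.Nat.ListAction using (sum)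
open import Data.Product using (_×_; _,_)
open import Data.List.Membership.Propositional using (_∈_)
open import Relation.Binary.PropositionalEquality using (_≡_)
open import Function.Bundles using (_⇔_)

Graph : ℕ → Set
Graph n = Fin n → Fin n → Bool

edgeCount : ∀ {n} → Graph n → ℕ
edgeCount {n} G =
  sum (map (λ u → sum (map (λ v → if G u v then 1 else 0) (allFin n))) (allFin n))

_⊆ᴳ_ : ∀ {n} → Graph n → Graph n → Set
H ⊆ᴳ G = ∀ u v → H u v ≡ true → G u v ≡ true

_∖_ : ∀ {n} → Graph n → Graph n → Graph n
(G ∖ F) u v = G u v ∧ not (F u v)

data Reach {n} (G : Graph n) : Fin n → Fin n → Set where
  here : ∀ {s} → Reach G s s
  step : ∀ {s u t} → G s u ≡ true → Reach G u t → Reach G s t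

FTRS : ∀ {n} → ℕ → Graph n → List (Fin n × Fin n) → Graph n → Set
FTRS k G P H =
  H ⊆ᴳ G ×
  (∀ s t → (s , t) ∈ P → (F : Graph _) → F ⊆ᴳ G → edgeCount F ≤ k →
     (Reach (G ∖ F) s t ⇔ Reach (H ∖ F) s t))

-- Take k sources s_a and k targets t_b, an out-path x_a with levels 0 … h entered from s_a at
-- level 0, an in-path y_b with levels 0 … h left towards t_b from level h, and a cross edge from
-- every x_{a,v} to every y_{b,v+1}.  Once the two path edges x_{a,v} x_{a,v+1} and
-- y_{b,v} y_{b,v+1} fail, the cross edge x_{a,v} y_{b,v+1} is the only way from s_a to t_b, so a
-- 2-fault-tolerant reachability subgraph for the pairs (s_a , t_b) keeps all k²h cross edges.
-- With k ≈ min (√r , n/8) and h ≈ n/(8k) this is Ω(n √r); the remaining vertices are isolated,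
-- and padding the k² pairs to r pairs only strengthens the hypothesis on the subgraph.

module Submission where

open import Defs
open import Data.Bool using (true; false; if_then_else_)
open import Data.Bool.Properties using () renaming (_≟_ to _≟ᵇ_)
open import Data.Empty using (⊥; ⊥-elim)
open import Data.Fin using (Fin; zero; suc; toℕ; fromℕ; fromℕ<; inject₁; _≟_)
open import Data.Fin.Properties
  using (toℕ-injective; toℕ<n; toℕ-fromℕ; toℕ-fromℕ<; toℕ-inject₁; +↔⊎; *↔×)
open import Data.List using (List; []; _∷_; _++_; length; map; filter; allFin; cartesianProduct)
open import Data.List.Properties using (length-++; length-map; filter-++; length-tabulate)
open import Data.List.Membership.Propositional using (_∈_; _∉_; find; lose)
open import Data.List.Membership.Propositional.Properties
  using (∈-∃++; ∈-++⁻; ∈-++⁺ˡ; ∈-++⁺ʳ; ∈-map⁺; ∈-map⁻; ∈-filter⁺; ∈-filter⁻; ∈-allFin;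
         ∈-cartesianProduct⁺)
import Data.List.Membership.DecPropositional as DecMembership
open import Data.List.Relation.Binary.Subset.Propositional using (_⊆_)
open import Data.List.Relation.Unary.All.Properties using (¬Any⇒All¬; All¬⇒¬Any)
open import Data.List.Relation.Unary.Any using (here; there; any?)
open import Data.List.Relation.Unary.Unique.Propositional using (Unique; []; _∷_)
open import Data.List.Relation.Unary.Unique.Propositional.Properties
  using (map⁺; filter⁺; cartesianProduct⁺; allFin⁺)
open import Data.Nat as ℕ
  using (ℕ; zero; suc; _+_; _*_; _∸_; _^_; _≤_; _<_; _≤?_; z≤n; s≤s; _/_; _%_; NonZero)
open import Data.Nat.DivMod using (m≡m%n+[m/n]*n; m%n<n; m/n*n≤m; m≥n⇒m/n>0)
open import Data.Nat.ListAction using (sum)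
open import Data.Nat.Properties hiding (_≟_)
open import Data.Nat.Tactic.RingSolver using (solve-∀)
open import Data.Product as Product using (_×_; _,_; proj₁; proj₂; ∃-syntax; uncurry)
open import Data.Product.Properties using () renaming (≡-dec to ×-≡-dec)
open import Data.Sum using (_⊎_; inj₁; inj₂)
open import Data.Sum.Function.Propositional using (_⊎-↔_)
open import Function using (_∘_; id)
open import Function.Bundles using (_↔_; Inverse; Equivalence)
open import Function.Properties.Inverse using (↔-refl; ↔-trans)
open import Relation.Binary.Definitions using (DecidableEquality)
open import Relation.Binary.PropositionalEquality
  using (_≡_; _≢_; refl; sym; trans; cong; cong₂; subst; module ≡-Reasoning)
open import Relation.Nullary using (Dec; yes; no; does; ¬?; _×-dec_; contradiction)
open import Relation.Nullary.Decidable using (dec-true; dec-false; decidable-stable)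

does≡true⇒ : ∀ {A : Set} (a? : Dec A) → does a? ≡ true → A
does≡true⇒ (yes a) _ = a

module _ {A : Set} where

  unique∧⊆⇒length≤ : {xs ys : List A} → Unique xs → xs ⊆ ys → length xs ≤ length ys
  unique∧⊆⇒length≤ [] _ = z≤n
  unique∧⊆⇒length≤ {x ∷ xs} (x∉xs ∷ xs!) xs⊆ys with ∈-∃++ (xs⊆ys (here refl))
  ... | ys₁ , ys₂ , refl = begin
    suc (length xs)                 ≤⟨ s≤s (unique∧⊆⇒length≤ xs! xs⊆ys₁++ys₂) ⟩
    suc (length (ys₁ ++ ys₂))       ≡⟨ cong suc (length-++ ys₁) ⟩
    suc (length ys₁ + length ys₂)   ≡⟨ +-suc (length ys₁) (length ys₂) ⟨
    length ys₁ + length (x ∷ ys₂)   ≡⟨ length-++ ys₁ ⟨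
    length (ys₁ ++ x ∷ ys₂)         ∎
    where
    open ≤-Reasoning
    xs⊆ys₁++ys₂ : xs ⊆ ys₁ ++ ys₂
    xs⊆ys₁++ys₂ {y} y∈xs with ∈-++⁻ ys₁ (xs⊆ys (there y∈xs))
    ... | inj₁ y∈ys₁         = ∈-++⁺ˡ y∈ys₁
    ... | inj₂ (here refl)   = ⊥-elim (All¬⇒¬Any x∉xs y∈xs)
    ... | inj₂ (there y∈ys₂) = ∈-++⁺ʳ ys₁ y∈ys₂

  length-cartesianProduct : ∀ {B : Set} (xs : List A) (ys : List B) →
    length (cartesianProduct xs ys) ≡ length xs * length ys
  length-cartesianProduct []       ys = refl
  length-cartesianProduct (x ∷ xs) ys = trans (length-++ (map (x ,_) ys))
    (cong₂ _+_ (length-map (x ,_) ys) (length-cartesianProduct xs ys))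

module _ {A : Set} (_≟ᴬ_ : DecidableEquality A) where
  open DecMembership _≟ᴬ_ using (_∈?_)

  ∃-∉ : {U Q : List A} → Unique U → length Q < length U → ∃[ x ] (x ∈ U × x ∉ Q)
  ∃-∉ {U} {Q} U! |Q|<|U| with any? (λ x → ¬? (x ∈? Q)) U
  ... | yes new = find new
  ... | no none = contradiction (unique∧⊆⇒length≤ U! U⊆Q) (<⇒≱ |Q|<|U|)
    where
    U⊆Q : U ⊆ Q
    U⊆Q {x} x∈U = decidable-stable (x ∈? Q) (λ x∉Q → none (lose x∈U x∉Q))

  extend-unique : {U : List A} → Unique U → ∀ d {Q} → Unique Q → length Q + d ≤ length U →
    ∃[ P ] (Unique P × length P ≡ length Q + d × Q ⊆ P)
  extend-unique U! zero {Q} Q! _ = Q , Q! , sym (+-identityʳ _) , id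
  extend-unique U! (suc d) {Q} Q! room with ∃-∉ {Q = Q} U! (<-≤-trans (m<m+n _ (s≤s z≤n)) room)
  ... | x , _ , x∉Q with extend-unique U! d (¬Any⇒All¬ Q x∉Q ∷ Q!) (≤-trans (≤-reflexive (sym (+-suc _ d))) room)
  ... | P , P! , |P| , x∷Q⊆P = P , P! , trans |P| (sym (+-suc _ d)) , x∷Q⊆P ∘ there

  pad-unique : {U Q : List A} → Unique U → Unique Q → ∀ {r} → length Q ≤ r → r ≤ length U →
    ∃[ P ] (Unique P × length P ≡ r × Q ⊆ P)
  pad-unique {U} {Q} U! Q! {r} |Q|≤r r≤|U|
    with extend-unique U! (r ∸ length Q) Q! (subst (_≤ length U) (sym (m+[n∸m]≡n |Q|≤r)) r≤|U|)
  ... | P , P! , |P| , Q⊆P = P , P! , trans |P| (m+[n∸m]≡n |Q|≤r) , Q⊆P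

length-allFin : ∀ n → length (allFin n) ≡ n
length-allFin n = length-tabulate id

allPairs : ∀ n → List (Fin n × Fin n)
allPairs n = cartesianProduct (allFin n) (allFin n)

allPairs-unique : ∀ n → Unique (allPairs n)
allPairs-unique n = cartesianProduct⁺ (allFin⁺ n) (allFin⁺ n)

length-allPairs : ∀ n → length (allPairs n) ≡ n * n
length-allPairs n =
  trans (length-cartesianProduct (allFin n) (allFin n)) (cong₂ _*_ (length-allFin n) (length-allFin n))

module _ {n : ℕ} where

  _≟ᵉ_ : DecidableEquality (Fin n × Fin n)
  _≟ᵉ_ = ×-≡-dec _≟_ _≟_

  hasEdge? : (G : Graph n) (e : Fin n × Fin n) → Dec (uncurry G e ≡ true)
  hasEdge? G e = uncurry G e ≟ᵇ true

  edgeList : Graph n → List (Fin n × Fin n)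
  edgeList G = filter (hasEdge? G) (allPairs n)

  edgeCount≡length-edgeList : (G : Graph n) → edgeCount G ≡ length (edgeList G)
  edgeCount≡length-edgeList G = count (allFin n)
    where
    keep : List (Fin n × Fin n) → List (Fin n × Fin n)
    keep = filter (hasEdge? G)
    row : Fin n → List (Fin n) → ℕ
    row u vs = sum (map (λ v → if G u v then 1 else 0) vs)
    count-row : ∀ u vs → row u vs ≡ length (keep (map (u ,_) vs))
    count-row u [] = refl
    count-row u (v ∷ vs) with G u v
    ... | true  = cong suc (count-row u vs)
    ... | false = count-row u vs
    count : ∀ us → sum (map (λ u → row u (allFin n)) us) ≡ length (keep (cartesianProduct us (allFin n)))
    count [] = refl
    count (u ∷ us) = begin
      row u (allFin n) + sum (map (λ u → row u (allFin n)) us)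
        ≡⟨ cong₂ _+_ (count-row u (allFin n)) (count us) ⟩
      length (keep (map (u ,_) (allFin n))) + length (keep (cartesianProduct us (allFin n)))
        ≡⟨ length-++ (keep (map (u ,_) (allFin n))) ⟨
      length (keep (map (u ,_) (allFin n)) ++ keep (cartesianProduct us (allFin n)))
        ≡⟨ cong length (filter-++ (hasEdge? G) (map (u ,_) (allFin n)) (cartesianProduct us (allFin n))) ⟨
      length (keep (cartesianProduct (u ∷ us) (allFin n))) ∎
      where open ≡-Reasoning

  edgeList-unique : (G : Graph n) → Unique (edgeList G)
  edgeList-unique G = filter⁺ (hasEdge? G) (allPairs-unique n)

  ∈-edgeList⁺ : ∀ {G : Graph n} {i j} → G i j ≡ true → (i , j) ∈ edgeList G
  ∈-edgeList⁺ {G} {i} {j} Gij = ∈-filter⁺ (hasEdge? G) (∈-cartesianProduct⁺ (∈-allFin i) (∈-allFin j)) Gij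

  ∈-edgeList⁻ : ∀ {G : Graph n} {e} → e ∈ edgeList G → uncurry G e ≡ true
  ∈-edgeList⁻ {G} e∈ = proj₂ (∈-filter⁻ (hasEdge? G) {xs = allPairs n} e∈)

  length≤edgeCount : ∀ {H : Graph n} {L} → Unique L → (∀ {i j} → (i , j) ∈ L → H i j ≡ true) →
    length L ≤ edgeCount H
  length≤edgeCount {H} L! edges = subst (_ ≤_) (sym (edgeCount≡length-edgeList H))
    (unique∧⊆⇒length≤ L! (∈-edgeList⁺ ∘ edges))

  edgeCount≤length : ∀ {F : Graph n} {L} → (∀ {i j} → F i j ≡ true → (i , j) ∈ L) →
    edgeCount F ≤ length L
  edgeCount≤length {F} within = subst (_≤ _) (sym (edgeCount≡length-edgeList F))
    (unique∧⊆⇒length≤ (edgeList-unique F) (within ∘ ∈-edgeList⁻))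

  open DecMembership _≟ᵉ_ using (_∈?_)

  graphOf : List (Fin n × Fin n) → Graph n
  graphOf L i j = does ((i , j) ∈? L)

  graphOf⇒∈ : ∀ {L i j} → graphOf L i j ≡ true → (i , j) ∈ L
  graphOf⇒∈ {L} = does≡true⇒ (_ ∈? L)

  edgeCount-graphOf : ∀ L → edgeCount (graphOf L) ≤ length L
  edgeCount-graphOf L = edgeCount≤length (graphOf⇒∈ {L})

  ∖-graphOf⁺ : ∀ {G : Graph n} {L i j} → G i j ≡ true → (i , j) ∉ L → (G ∖ graphOf L) i j ≡ true
  ∖-graphOf⁺ {L = L} {i} {j} Gij ij∉L rewrite Gij | dec-false ((i , j) ∈? L) ij∉L = refl

  ∖-graphOf⁻ : ∀ {G : Graph n} {L i j} → (G ∖ graphOf L) i j ≡ true → G i j ≡ true × (i , j) ∉ L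
  ∖-graphOf⁻ {G} {L} {i} {j} e with G i j | (i , j) ∈? L
  ... | true | no ij∉L = refl , ij∉L
  ∖-graphOf⁻ () | true | yes _
  ∖-graphOf⁻ () | false | _

FTRS-antitone : ∀ {n k} {G H : Graph n} {P Q} → Q ⊆ P → FTRS k G P H → FTRS k G Q H
FTRS-antitone Q⊆P (H⊆G , preserves) = H⊆G , λ s t st∈Q → preserves s t (Q⊆P st∈Q)

module _ {n : ℕ} {G : Graph n} where

  Reach-trans : ∀ {s u t} → Reach G s u → Reach G u t → Reach G s t
  Reach-trans here         q = q
  Reach-trans (step e p) q = step e (Reach-trans p q)

  Reach-invariant : (I : Fin n → Set) → (∀ i j → G i j ≡ true → I i → I j) →
    ∀ {s t} → Reach G s t → I s → I t
  Reach-invariant I closed here         Is = Is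
  Reach-invariant I closed (step e p) Is = Reach-invariant I closed p (closed _ _ e Is)

  Reach-ladder : ∀ {m} (f : Fin m → Fin n) {lo hi : Fin m} →
    (∀ {x x′} → toℕ lo ≤ toℕ x → toℕ x′ ≡ suc (toℕ x) → toℕ x′ ≤ toℕ hi → G (f x) (f x′) ≡ true) →
    toℕ lo ≤ toℕ hi → Reach G (f lo) (f hi)
  Reach-ladder {m} f {lo} {hi} rung lo≤hi = climb (toℕ hi ∸ toℕ lo) lo ≤-refl (m+[n∸m]≡n lo≤hi)
    where
    climb : ∀ d x → toℕ lo ≤ toℕ x → toℕ x + d ≡ toℕ hi → Reach G (f x) (f hi)
    climb zero x _ x+0≡hi = subst (Reach G (f x) ∘ f) (toℕ-injective (trans (sym (+-identityʳ _)) x+0≡hi)) here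
    climb (suc d) x lo≤x x+d≡hi = step (rung lo≤x (toℕ-fromℕ< x⁺<m) x⁺≤hi)
      (climb d x⁺ (≤-trans lo≤x (≤-trans (n≤1+n _) (≤-reflexive (sym (toℕ-fromℕ< x⁺<m)))))
             (trans (cong (_+ d) (toℕ-fromℕ< x⁺<m)) (trans (sym (+-suc _ d)) x+d≡hi)))
      where
      x⁺≤hi′ : suc (toℕ x) ≤ toℕ hi
      x⁺≤hi′ = subst (suc (toℕ x) ≤_) x+d≡hi
        (≤-trans (s≤s (m≤m+n (toℕ x) d)) (≤-reflexive (sym (+-suc (toℕ x) d))))
      x⁺<m : suc (toℕ x) < m
      x⁺<m = ≤-<-trans x⁺≤hi′ (toℕ<n hi)
      x⁺ : Fin m
      x⁺ = fromℕ< x⁺<m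
      x⁺≤hi : toℕ x⁺ ≤ toℕ hi
      x⁺≤hi = subst (_≤ toℕ hi) (sym (toℕ-fromℕ< x⁺<m)) x⁺≤hi′

-- The gadget

module Gadget (k h rest : ℕ) where

  Level : Set
  Level = Fin (suc h)

  Vertex : Set
  Vertex = Fin k ⊎ Fin k ⊎ (Fin k × Level) ⊎ (Fin k × Level) ⊎ Fin rest

  pattern source a    = inj₁ a
  pattern target b    = inj₂ (inj₁ b)
  pattern outPath a x = inj₂ (inj₂ (inj₁ (a , x)))
  pattern inPath b y  = inj₂ (inj₂ (inj₂ (inj₁ (b , y))))
  pattern isolated z  = inj₂ (inj₂ (inj₂ (inj₂ z)))

  N : ℕ
  N = k + (k + (k * suc h + (k * suc h + rest)))

  encoding : Fin N ↔ Vertex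
  encoding = ↔-trans +↔⊎ (↔-refl ⊎-↔ ↔-trans +↔⊎ (↔-refl ⊎-↔ ↔-trans +↔⊎
    (*↔× ⊎-↔ ↔-trans +↔⊎ (*↔× ⊎-↔ ↔-refl))))

  open Inverse encoding using () renaming (to to view; from to vertex)

  view-vertex : ∀ X → view (vertex X) ≡ X
  view-vertex = Inverse.strictlyInverseˡ encoding

  vertex-view : ∀ i → vertex (view i) ≡ i
  vertex-view = Inverse.strictlyInverseʳ encoding

  encode : Vertex × Vertex → Fin N × Fin N
  encode = Product.map vertex vertex

  encode-view : ∀ i j → encode (view i , view j) ≡ (i , j)
  encode-view i j = cong₂ _,_ (vertex-view i) (vertex-view j)

  encode-injective : ∀ {p q} → encode p ≡ encode q → p ≡ q
  encode-injective {X , Y} {X′ , Y′} eq = cong₂ _,_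
    (trans (sym (view-vertex X)) (trans (cong (view ∘ proj₁) eq) (view-vertex X′)))
    (trans (sym (view-vertex Y)) (trans (cong (view ∘ proj₂) eq) (view-vertex Y′)))

  ∈-map-encode⁻ : ∀ {p L} → encode p ∈ map encode L → p ∈ L
  ∈-map-encode⁻ {p} e∈ with ∈-map⁻ encode e∈
  ... | q , q∈L , eq = subst (_∈ _) (sym (encode-injective eq)) q∈L

  Edge : Vertex → Vertex → Set
  Edge (source a)    (outPath a′ x)  = a ≡ a′ × x ≡ zero
  Edge (outPath a x) (outPath a′ x′) = a ≡ a′ × toℕ x′ ≡ suc (toℕ x)
  Edge (outPath _ x) (inPath _ y)    = toℕ y ≡ suc (toℕ x)
  Edge (inPath b y)  (inPath b′ y′)  = b ≡ b′ × toℕ y′ ≡ suc (toℕ y)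
  Edge (inPath b y)  (target b′)     = b ≡ b′ × y ≡ fromℕ h
  Edge _             _               = ⊥

  edge? : ∀ X Y → Dec (Edge X Y)
  edge? (source a)    (outPath a′ x)  = a ≟ a′ ×-dec x ≟ zero
  edge? (outPath a x) (outPath a′ x′) = a ≟ a′ ×-dec toℕ x′ ℕ.≟ suc (toℕ x)
  edge? (outPath _ x) (inPath _ y)    = toℕ y ℕ.≟ suc (toℕ x)
  edge? (inPath b y)  (inPath b′ y′)  = b ≟ b′ ×-dec toℕ y′ ℕ.≟ suc (toℕ y)
  edge? (inPath b y)  (target b′)     = b ≟ b′ ×-dec y ≟ fromℕ h
  edge? (source _)    (source _)      = no λ ()
  edge? (source _)    (target _)      = no λ ()
  edge? (source _)    (inPath _ _)    = no λ ()
  edge? (source _)    (isolated _)    = no λ ()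
  edge? (outPath _ _) (source _)      = no λ ()
  edge? (outPath _ _) (target _)      = no λ ()
  edge? (outPath _ _) (isolated _)    = no λ ()
  edge? (inPath _ _)  (source _)      = no λ ()
  edge? (inPath _ _)  (outPath _ _)   = no λ ()
  edge? (inPath _ _)  (isolated _)    = no λ ()
  edge? (target _)    _               = no λ ()
  edge? (isolated _)  _               = no λ ()

  G : Graph N
  G i j = does (edge? (view i) (view j))

  Edge⇒G : ∀ {X Y} → Edge X Y → G (vertex X) (vertex Y) ≡ true
  Edge⇒G {X} {Y} e rewrite view-vertex X | view-vertex Y = dec-true (edge? X Y) e

  G⇒Edge : ∀ {i j} → G i j ≡ true → Edge (view i) (view j)
  G⇒Edge = does≡true⇒ (edge? _ _)

  demand : Fin k × Fin k → Fin N × Fin N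
  demand (a , b) = encode (source a , target b)

  demands : List (Fin N × Fin N)
  demands = map demand (allPairs k)

  demands-unique : Unique demands
  demands-unique = map⁺ demand-injective (allPairs-unique k)
    where
    demand-injective : ∀ {p q} → demand p ≡ demand q → p ≡ q
    demand-injective {a , b} {a′ , b′} eq with encode-injective {source a , target b} {source a′ , target b′} eq
    ... | refl = refl

  length-demands : length demands ≡ k * k
  length-demands = trans (length-map demand (allPairs k)) (length-allPairs k)

  ∈-demands : ∀ a b → (vertex (source a) , vertex (target b)) ∈ demands
  ∈-demands a b = ∈-map⁺ demand (∈-cartesianProduct⁺ (∈-allFin a) (∈-allFin b))

  crossPair : Fin k → Fin k → Fin h → Vertex × Vertex
  crossPair a b v = outPath a (inject₁ v) , inPath b (suc v)

  crossEdge : (Fin k × Fin k) × Fin h → Fin N × Fin N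
  crossEdge ((a , b) , v) = encode (crossPair a b v)

  crossEdges : List (Fin N × Fin N)
  crossEdges = map crossEdge (cartesianProduct (allPairs k) (allFin h))

  crossEdges-unique : Unique crossEdges
  crossEdges-unique = map⁺ crossEdge-injective
    (cartesianProduct⁺ (allPairs-unique k) (allFin⁺ h))
    where
    crossEdge-injective : ∀ {p q} → crossEdge p ≡ crossEdge q → p ≡ q
    crossEdge-injective {(a , b) , v} {(a′ , b′) , v′} eq
      with encode-injective {crossPair a b v} {crossPair a′ b′ v′} eq
    ... | refl = refl

  length-crossEdges : length crossEdges ≡ k * k * h
  length-crossEdges = begin
    length crossEdges                                  ≡⟨ length-map crossEdge (cartesianProduct (allPairs k) (allFin h)) ⟩
    length (cartesianProduct (allPairs k) (allFin h))  ≡⟨ length-cartesianProduct (allPairs k) (allFin h) ⟩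
    length (allPairs k) * length (allFin h)            ≡⟨ cong₂ _*_ (length-allPairs k) (length-allFin h) ⟩
    k * k * h                                          ∎
    where open ≡-Reasoning

  module Cut (a b : Fin k) (v : Fin h) where

    faultPairs : List (Vertex × Vertex)
    faultPairs = (outPath a (inject₁ v) , outPath a (suc v)) ∷ (inPath b (inject₁ v) , inPath b (suc v)) ∷ []

    faults : Graph N
    faults = graphOf (map encode faultPairs)

    faultPairs⇒Edge : ∀ {X Y} → (X , Y) ∈ faultPairs → Edge X Y
    faultPairs⇒Edge (here refl)         = refl , cong suc (sym (toℕ-inject₁ v))
    faultPairs⇒Edge (there (here refl)) = refl , cong suc (sym (toℕ-inject₁ v))

    faults⊆G : faults ⊆ᴳ G
    faults⊆G i j f with ∈-map⁻ encode (graphOf⇒∈ f)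
    ... | (X , Y) , XY∈ , eq = subst (λ e → uncurry G e ≡ true) (sym eq) (Edge⇒G (faultPairs⇒Edge XY∈))

    survives : ∀ X Y → Edge X Y → (X , Y) ∉ faultPairs → (G ∖ faults) (vertex X) (vertex Y) ≡ true
    survives _ _ e XY∉ = ∖-graphOf⁺ {G = G} (Edge⇒G e) (XY∉ ∘ ∈-map-encode⁻)

    outPath-notFault : ∀ {x x′} → toℕ x′ ≤ toℕ v → (outPath a x , outPath a x′) ∉ faultPairs
    outPath-notFault x′≤v (here refl)         = 1+n≰n x′≤v
    outPath-notFault _    (there (here ()))
    outPath-notFault _    (there (there ()))

    inPath-notFault : ∀ {y y′} → toℕ v < toℕ y → (inPath b y , inPath b y′) ∉ faultPairs
    inPath-notFault _   (here ())
    inPath-notFault v<y (there (here refl)) = <-irrefl (sym (toℕ-inject₁ v)) v<y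
    inPath-notFault _   (there (there ()))

    enter : (G ∖ faults) (vertex (source a)) (vertex (outPath a zero)) ≡ true
    enter = survives (source a) (outPath a zero) (refl , refl)
      λ { (here ()) ; (there (here ())) ; (there (there ())) }

    cross : (G ∖ faults) (vertex (outPath a (inject₁ v))) (vertex (inPath b (suc v))) ≡ true
    cross = survives (outPath a (inject₁ v)) (inPath b (suc v)) (cong suc (sym (toℕ-inject₁ v)))
      λ { (here ()) ; (there (here ())) ; (there (there ())) }

    exit : (G ∖ faults) (vertex (inPath b (fromℕ h))) (vertex (target b)) ≡ true
    exit = survives (inPath b (fromℕ h)) (target b) (refl , refl)
      λ { (here ()) ; (there (here ())) ; (there (there ())) }

    climb-outPath : Reach (G ∖ faults) (vertex (outPath a zero)) (vertex (outPath a (inject₁ v)))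
    climb-outPath = Reach-ladder (λ x → vertex (outPath a x))
      (λ _ x⋖x′ x′≤v → survives (outPath a _) (outPath a _) (refl , x⋖x′)
                         (outPath-notFault (subst (_ ≤_) (toℕ-inject₁ v) x′≤v)))
      z≤n

    climb-inPath : Reach (G ∖ faults) (vertex (inPath b (suc v))) (vertex (inPath b (fromℕ h)))
    climb-inPath = Reach-ladder (λ y → vertex (inPath b y))
      (λ v<y y⋖y′ _ → survives (inPath b _) (inPath b _) (refl , y⋖y′) (inPath-notFault v<y))
      (subst (suc (toℕ v) ≤_) (sym (toℕ-fromℕ h)) (toℕ<n v))

    sourceToTarget : Reach (G ∖ faults) (vertex (source a)) (vertex (target b))
    sourceToTarget =
      step enter (Reach-trans climb-outPath (step cross (Reach-trans climb-inPath (step exit here))))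

    -- Contains everything s_a reaches once the faults and the cross edge x_{a,v} y_{b,v+1} are gone.
    SourceSide : Vertex → Set
    SourceSide (source a′)    = a′ ≡ a
    SourceSide (outPath a′ x) = a′ ≡ a × toℕ x ≤ toℕ v
    SourceSide (inPath b′ y)  = b′ ≡ b → toℕ y ≤ toℕ v
    SourceSide (target b′)    = b′ ≢ b
    SourceSide (isolated _)   = ⊥

    blocked : List (Vertex × Vertex)
    blocked = crossPair a b v ∷ faultPairs

    cut-or-below : ∀ {x x′ : Level} → toℕ x ≤ toℕ v → toℕ x′ ≡ suc (toℕ x) →
      (x , x′) ≡ (inject₁ v , suc v) ⊎ toℕ x′ ≤ toℕ v
    cut-or-below x≤v x⋖x′ with m≤n⇒m<n∨m≡n x≤v
    ... | inj₁ x<v = inj₂ (subst (_≤ toℕ v) (sym x⋖x′) x<v)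
    ... | inj₂ x≡v = inj₁ (cong₂ _,_ (toℕ-injective (trans x≡v (sym (toℕ-inject₁ v))))
                                      (toℕ-injective (trans x⋖x′ (cong suc x≡v))))

    SourceSide-step : ∀ X Y → Edge X Y → (X , Y) ∉ blocked → SourceSide X → SourceSide Y
    SourceSide-step (source _) (outPath _ _) (refl , refl) _ refl = refl , z≤n
    SourceSide-step (outPath _ _) (outPath _ _) (refl , x⋖x′) XY∉ (refl , x≤v) with cut-or-below x≤v x⋖x′
    ... | inj₁ refl = contradiction (there (here refl)) XY∉
    ... | inj₂ x′≤v = refl , x′≤v
    SourceSide-step (outPath _ _) (inPath _ _) x⋖y XY∉ (refl , x≤v) refl with cut-or-below x≤v x⋖y
    ... | inj₁ refl = contradiction (here refl) XY∉
    ... | inj₂ y≤v  = y≤v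
    SourceSide-step (inPath _ _) (inPath _ _) (refl , y⋖y′) XY∉ y≤v refl with cut-or-below (y≤v refl) y⋖y′
    ... | inj₁ refl = contradiction (there (there (here refl))) XY∉
    ... | inj₂ y′≤v = y′≤v
    SourceSide-step (inPath _ _) (target _) (refl , refl) _ last≤v refl =
      <⇒≱ (toℕ<n v) (subst (_≤ toℕ v) (toℕ-fromℕ h) (last≤v refl))
    SourceSide-step (source _)    (source _)   ()
    SourceSide-step (source _)    (target _)   ()
    SourceSide-step (source _)    (inPath _ _) ()
    SourceSide-step (source _)    (isolated _) ()
    SourceSide-step (outPath _ _) (source _)   ()
    SourceSide-step (outPath _ _) (target _)   ()
    SourceSide-step (outPath _ _) (isolated _) ()
    SourceSide-step (inPath _ _)  (source _)   ()
    SourceSide-step (inPath _ _)  (outPath _ _) ()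
    SourceSide-step (inPath _ _)  (isolated _) ()
    SourceSide-step (target _)    _            ()
    SourceSide-step (isolated _)  _            ()

    crossEdge-forced : ∀ {H} → FTRS 2 G demands H → uncurry H (encode (crossPair a b v)) ≡ true
    crossEdge-forced {H} (H⊆G , preserves) with uncurry H (encode (crossPair a b v)) in H-cross
    ... | true  = refl
    ... | false = ⊥-elim (subst SourceSide (view-vertex (target b))
                    (Reach-invariant (SourceSide ∘ view) closed reach start) refl)
      where
      reach : Reach (H ∖ faults) (vertex (source a)) (vertex (target b))
      reach = Equivalence.to
        (preserves _ _ (∈-demands a b) faults faults⊆G (edgeCount-graphOf (map encode faultPairs)))
        sourceToTarget
      start : SourceSide (view (vertex (source a)))
      start = subst SourceSide (sym (view-vertex (source a))) refl
      closed : ∀ i j → (H ∖ faults) i j ≡ true → SourceSide (view i) → SourceSide (view j)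
      closed i j e with ∖-graphOf⁻ {G = H} e
      ... | Hij , ij∉faults = SourceSide-step (view i) (view j) (G⇒Edge (H⊆G i j Hij)) unblocked
        where
        unblocked : (view i , view j) ∉ blocked
        unblocked (here eq) with trans (sym H-cross)
          (subst (λ e → uncurry H e ≡ true) (trans (sym (encode-view i j)) (cong encode eq)) Hij)
        ... | ()
        unblocked (there p∈) =
          ij∉faults (subst (_∈ map encode faultPairs) (encode-view i j) (∈-map⁺ encode p∈))

  edgeCount-lower-bound : ∀ {H} → FTRS 2 G demands H → k * k * h ≤ edgeCount H
  edgeCount-lower-bound {H} ftrs =
    subst (_≤ edgeCount H) length-crossEdges (length≤edgeCount crossEdges-unique forced)
    where
    forced : ∀ {i j} → (i , j) ∈ crossEdges → H i j ≡ true
    forced e∈ with ∈-map⁻ crossEdge e∈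
    ... | ((a , b) , v) , _ , eq =
      subst (λ e → uncurry H e ≡ true) (sym eq) (Cut.crossEdge-forced a b v ftrs)

  hard-pairs : ∀ {r} → k * k ≤ r → r ≤ N ^ 2 →
    ∃[ P ] (Unique P × length P ≡ r × ((H : Graph N) → FTRS 2 G P H → k * k * h ≤ edgeCount H))
  hard-pairs k²≤r r≤N²
    with pad-unique _≟ᵉ_ (allPairs-unique N) demands-unique (subst (_≤ _) (sym length-demands) k²≤r)
                    (subst (_ ≤_) (trans (cong (N *_) (*-identityʳ N)) (sym (length-allPairs N))) r≤N²)
  ... | P , P! , |P| , demands⊆P = P , P! , |P| , λ H ftrs → edgeCount-lower-bound (FTRS-antitone demands⊆P ftrs)

-- Choosing the dimensions

floor-sqrt : ∀ r → ∃[ s ] (s * s ≤ r × r < suc s * suc s)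
floor-sqrt zero = 0 , z≤n , s≤s z≤n
floor-sqrt (suc r) with floor-sqrt r
... | s , s²≤r , r<[s+1]² with suc s * suc s ≤? suc r
...   | yes [s+1]²≤r+1 = suc s , [s+1]²≤r+1 , ≤-<-trans r<[s+1]² (*-mono-< (n<1+n (suc s)) (n<1+n (suc s)))
...   | no  [s+1]²≰r+1 = s , ≤-trans s²≤r (n≤1+n r) , ≰⇒> [s+1]²≰r+1

division-bounds : ∀ n d .{{_ : NonZero d}} → d * (n / d) ≤ n × n < d * suc (n / d)
division-bounds n d = subst (_≤ n) (*-comm (n / d) d) (m/n*n≤m n d) , (begin-strict
  n                  ≡⟨ m≡m%n+[m/n]*n n d ⟩
  n % d + n / d * d  <⟨ +-monoˡ-< (n / d * d) (m%n<n n d) ⟩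
  d + n / d * d      ≡⟨ cong (d +_) (*-comm (n / d) d) ⟩
  d + d * (n / d)    ≡⟨ *-suc d (n / d) ⟨
  d * suc (n / d)    ∎)
  where open ≤-Reasoning

choose-k : ∀ {n r} → 8 ≤ n → 1 ≤ r → r ≤ n * n →
  ∃[ k ] (1 ≤ k × 8 * k ≤ n × k * k ≤ r × r ≤ 16 * k * (16 * k))
choose-k {n} {r} 8≤n 1≤r r≤n² with floor-sqrt r
... | s , s²≤r , r<[s+1]² with s ≤? n / 8
...   | yes s≤n/8 = s , 1≤s , ≤-trans (*-monoʳ-≤ 8 s≤n/8) (proj₁ (division-bounds n 8)) , s²≤r ,
                    ≤-trans (<⇒≤ r<[s+1]²) (*-mono-≤ 1+s≤16s 1+s≤16s)
  where
  1≤s : 1 ≤ s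
  1≤s = ≰⇒> λ s≤0 → <⇒≱ (subst (λ t → r < suc t * suc t) (n≤0⇒n≡0 s≤0) r<[s+1]²) 1≤r
  1+s≤16s : suc s ≤ 16 * s
  1+s≤16s = ≤-trans (+-monoˡ-≤ s 1≤s) (+-monoʳ-≤ s (m≤n*m s 15))
...   | no  s≰n/8 = k , 1≤k , proj₁ (division-bounds n 8) , ≤-trans (*-mono-≤ k≤s k≤s) s²≤r ,
                    ≤-trans r≤n² (*-mono-≤ n≤16k n≤16k)
  where
  k : ℕ
  k = n / 8
  1≤k : 1 ≤ k
  1≤k = m≥n⇒m/n>0 8≤n
  k≤s : k ≤ s
  k≤s = <⇒≤ (≰⇒> s≰n/8)
  n≤16k : n ≤ 16 * k
  n≤16k = ≤-trans (<⇒≤ (proj₂ (division-bounds n 8)))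
            (≤-trans (*-monoʳ-≤ 8 (+-monoˡ-≤ k 1≤k)) (≤-reflexive (8[k+k]≡16k k)))
    where
    8[k+k]≡16k : ∀ k → 8 * (k + k) ≡ 16 * k
    8[k+k]≡16k = solve-∀

layout-bounds : ∀ {n} k h → 1 ≤ h → 8 * k * h ≤ n → n < 8 * k * suc h →
  k + (k + (k * suc h + k * suc h)) ≤ n × n ≤ 16 * k * h
layout-bounds {n} k (suc h) _ 8kh≤n n<8k[h+1] =
  ≤-trans (≤-trans (m≤m+n _ (2 * k + 6 * (k * h))) (≤-reflexive (vertices k h))) 8kh≤n ,
  ≤-trans (<⇒≤ n<8k[h+1]) (≤-trans (m≤m+n _ (8 * (k * h))) (≤-reflexive (slack k h)))
  where
  vertices : ∀ k h → k + (k + (k * suc (suc h) + k * suc (suc h))) + (2 * k + 6 * (k * h)) ≡ 8 * k * suc h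
  vertices = solve-∀
  slack : ∀ k h → 8 * k * suc (suc h) + 8 * (k * h) ≡ 16 * k * suc h
  slack = solve-∀

square-bound : ∀ {n r a b} → n ≤ a → r ≤ b * b → n ^ 2 * r ≤ (a * b) ^ 2
square-bound {n} {r} {a} {b} n≤a r≤b² = begin
  n ^ 2 * r        ≤⟨ *-mono-≤ (^-monoˡ-≤ 2 n≤a) r≤b² ⟩
  a ^ 2 * (b * b)  ≡⟨ regroup a b ⟩
  (a * b) ^ 2      ∎
  where
  open ≤-Reasoning
  regroup : ∀ a b → a * (a * 1) * (b * b) ≡ a * b * (a * b * 1)
  regroup = solve-∀

dimensions : ∀ {n r} → 8 ≤ n → r ≤ n ^ 2 →
  ∃[ k ] ∃[ h ] ∃[ rest ] (k + (k + (k * suc h + (k * suc h + rest))) ≡ n × k * k ≤ r ×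
                           n ^ 2 * r ≤ (256 * (k * k * h)) ^ 2)
dimensions {n} {zero} _ _ = 0 , 0 , n , refl , z≤n , ≤-reflexive (*-zeroʳ (n ^ 2))
dimensions {n} {r@(suc _)} 8≤n r≤n² with choose-k 8≤n (s≤s z≤n) (subst (r ≤_) (cong (n *_) (*-identityʳ n)) r≤n²)
... | k@(suc _) , _ , 8k≤n , k²≤r , r≤[16k]² =
  k , h , n ∸ used , trans (regroup k h (n ∸ used)) (m+[n∸m]≡n used≤n) , k²≤r ,
  subst (λ m → n ^ 2 * r ≤ m ^ 2) (collect k h) (square-bound n≤16kh r≤[16k]²)
  where
  h : ℕ
  h = n / (8 * k)
  used : ℕ
  used = k + (k + (k * suc h + k * suc h))
  bounds : used ≤ n × n ≤ 16 * k * h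
  bounds = layout-bounds k h (m≥n⇒m/n>0 8k≤n) (proj₁ (division-bounds n (8 * k)))
                                               (proj₂ (division-bounds n (8 * k)))
  used≤n : used ≤ n
  used≤n = proj₁ bounds
  n≤16kh : n ≤ 16 * k * h
  n≤16kh = proj₂ bounds
  regroup : ∀ k h m → k + (k + (k * suc h + (k * suc h + m))) ≡ k + (k + (k * suc h + k * suc h)) + m
  regroup = solve-∀
  collect : ∀ k h → 16 * k * h * (16 * k) ≡ 256 * (k * k * h)
  collect = solve-∀

hard-instance : ∀ n r → 8 ≤ n → r ≤ n ^ 2 →
  ∃[ G ] ∃[ P ] (Unique {A = Fin n × Fin n} P × length P ≡ r ×
    ((H : Graph n) → FTRS 2 G P H → n ^ 2 * r ≤ (256 * edgeCount H) ^ 2))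
hard-instance n r 8≤n r≤n² with dimensions 8≤n r≤n²
... | k , h , rest , refl , k²≤r , bound with Gadget.hard-pairs k h rest k²≤r r≤n²
...   | P , P! , |P| , lower = Gadget.G k h rest , P , P! , |P| ,
        λ H ftrs → ≤-trans bound (^-monoˡ-≤ 2 (*-monoʳ-≤ 256 (lower H ftrs)))

theorem1p6 :
    ∃[ c ] ∃[ n₀ ] (1 ≤ c ×
      (∀ n r → n₀ ≤ n → r ≤ n ^ 2 →
        ∃[ G ] ∃[ P ] (Unique {A = Fin n × Fin n} P × length P ≡ r ×
          ((H : Graph n) → FTRS 2 G P H →
             (n ^ 2) * r ≤ (c * edgeCount H) ^ 2))))
theorem1p6 = 256 , 8 , s≤s z≤n , hard-instance
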